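{- For every integer $n \geq 6$: (a) $s_e(n) = s_o(n)$ whenever $n$ is not of any of the forms $\tfrac12(3t^2+t+4)$, $\tfrac12(3(t+1)^2-t-1)$, $\tfrac12(3(t+1)^2-t+3)$, $\tfrac12(3(t+1)^2+t+1)$ with $t$ an integer $\geq 2$; (b) $s_e(n) = s_o(n) - 1$ whenever $n = \tfrac12(3t^2+t+4)$ or $n = \tfrac12(3(t+1)^2+t+1)$ for some integer $t \geq 2$; (c) $s_e(n) = s_o(n) + 1$ whenever $n = \tfrac12(3(t+1)^2-t-1)$ or $n = \tfrac12(3(t+1)^2-t+3)$ for some integer $t \geq 2$.
   Context: A butterfly partition of $n$ is a partition of $n$ into distinct parts $p_1 > p_2 > \cdots > p_k$ with $k \geq 3$, $p_1 = p_2+1 = p_3+2$ (three largest parts consecutive) and smallest part $p_k \geq 2$. For $n \geq 6$, $s_e(n)$ denotes the number of butterfly partitions of $n$ whose second largest part $p_2$ is even, and $s_o(n)$ the number of butterfly partitions of $n$ whose second largest part $p_2$ is odd. -}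

module Defs where

open import Data.Nat using (ℕ; suc; _+_; _*_; _^_; _≤_; _>_)
open import Data.Nat.Divisibility using (_∣_)
open import Data.List using (List; []; _∷_; length)
open import Data.Nat.ListAction using (sum)
open import Data.List.Relation.Unary.All using (All)
open import Data.List.Relation.Unary.Linked using (Linked)
open import Data.List.Relation.Unary.Unique.Propositional using (Unique)
open import Data.List.Membership.Propositional using (_∈_)
open import Data.Product using (Σ; _×_)
open import Data.Sum using (_⊎_)
open import Relation.Nullary using (¬_)
open import Relation.Binary.PropositionalEquality using (_≡_)
open import Function.Bundles using (_⇔_)

DistinctPartition : ℕ → List ℕ → Set
DistinctPartition n ps = Linked _>_ ps × sum ps ≡ n

ButterflyWithSecond : ℕ → ℕ → List ℕ → Set
ButterflyWithSecond n p₂ ps =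
  DistinctPartition n ps × All (2 ≤_) ps ×
  Σ ℕ (λ p₁ → Σ ℕ (λ p₃ → Σ (List ℕ) (λ rest →
    ps ≡ p₁ ∷ p₂ ∷ p₃ ∷ rest × p₁ ≡ suc p₂ × p₂ ≡ suc p₃)))

ButterflyEven : ℕ → List ℕ → Set
ButterflyEven n ps = Σ ℕ (λ p₂ → ButterflyWithSecond n p₂ ps × 2 ∣ p₂)

ButterflyOdd : ℕ → List ℕ → Set
ButterflyOdd n ps = Σ ℕ (λ p₂ → ButterflyWithSecond n p₂ ps × ¬ (2 ∣ p₂))

HasCount : (List ℕ → Set) → ℕ → Set
HasCount P k = Σ (List (List ℕ)) (λ L →
  Unique L × ((ps : List ℕ) → (ps ∈ L) ⇔ P ps) × length L ≡ k)

-- The four exceptional forms (t ≥ 2), multiplied by 2 and with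
-- subtraction moved to the other side (all values are natural numbers):
-- n = (3t²+t+4)/2
Form1 : ℕ → ℕ → Set
Form1 t n = 2 * n ≡ 3 * t ^ 2 + t + 4
Form2 : ℕ → ℕ → Set
Form2 t n = 2 * n + t + 1 ≡ 3 * (t + 1) ^ 2
Form3 : ℕ → ℕ → Set
Form3 t n = 2 * n + t ≡ 3 * (t + 1) ^ 2 + 3
Form4 : ℕ → ℕ → Set
Form4 t n = 2 * n ≡ 3 * (t + 1) ^ 2 + t + 1

AnyForm : ℕ → Set
AnyForm n = Σ ℕ (λ t → 2 ≤ t × (Form1 t n ⊎ Form2 t n ⊎ Form3 t n ⊎ Form4 t n))

MinusForm : ℕ → Set
MinusForm n = Σ ℕ (λ t → 2 ≤ t × (Form1 t n ⊎ Form4 t n))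

PlusForm : ℕ → Set
PlusForm n = Σ ℕ (λ t → 2 ≤ t × (Form2 t n ⊎ Form3 t n))

{-# OPTIONS --safe #-}
module Submission where

-- butterflySeries is Σ_n (s_o(n) − s_e(n)) q^n.  A butterfly partition with p₂ = k + 3 is
-- (k+4, k+3, k+2) followed by distinct parts in [2, k+1], so
--   butterflySeries = Σ_{k ≥ 0} (-1)^k q^{3k+9} ∏_{i=2}^{k+1} (1 + q^i) = q^9 · altSum 2 3 0,
-- where altSum j r k = Σ_m (-1)^m q^{rm} ∏_{i=j}^{j+k+m-1} (1 + q^i).  Splitting off the smallest
-- or the largest factor of the product gives two recurrences for altSum; together they show that
-- ψ j = altSum j j 0 satisfies ψ j = 1 − q^j + q^{3j+1} ψ (j+1), so ψ j has the sparse expansion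
-- Σ_k q^{e(k)} (1 − q^{j+k}) with e(k) = ψExponent j k = Σ_{i<k} (3(j+i)+1).  Hence
-- butterflySeries = q^9 − (q^12 + q^14) ψ 3, whose nonzero coefficients sit exactly at n = 9 and
-- at the four families of exceptional n.

open import Defs
open import Data.Nat using (ℕ; zero; suc; _+_; _*_; _^_; _≤_; _<_; _>_; z≤n; s≤s)
open import Data.Nat.Properties
  using (≤-refl; ≤-reflexive; <⇒≤; <-irrefl; m≤n⇒m<n∨m≡n; ≤-trans; <-trans; <-≤-trans; ≤-pred; m≤n+m; m≤m+n; *-zeroʳ; *-cancelˡ-≡; +-cancelʳ-≡; +-identityʳ; +-suc; +-assoc; +-comm; >⇒≢; n≤1+n; suc-injective; m≢1+n+m; n<1+n; _≟_; _<?_; ≮⇒≥; m≤n⇒∃[o]m+o≡n)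
import Data.Nat.Tactic.RingSolver as ℕ-Ring
open import Data.Integer as ℤ using (ℤ; 0ℤ; 1ℤ; -1ℤ)
import Data.Integer.Properties as ℤ
import Data.Integer.Tactic.RingSolver as ℤ-Ring
open import Data.List using (List; []; _∷_; _++_; map; length)
open import Data.List.Properties using (length-++; length-map; ∷-injectiveˡ; ∷-injectiveʳ; ++-identityʳ)
open import Data.Bool.Properties using (not-involutive)
open import Data.Nat.Divisibility using (_∣_; divides; ∣-refl; ∣1⇒≡1; ∣m∣n⇒∣m+n; ∣m+n∣m⇒∣n)
open import Relation.Nullary.Reflects using (Reflects; ofʸ; ofⁿ; ¬-reflects; det; invert)
open import Function.Bundles using (_⇔_; mk⇔)
open import Data.Bool using (Bool; true; false; not; if_then_else_)
open import Data.Nat.ListAction using (sum)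
open import Data.List.Relation.Unary.All using (All; []; _∷_)
import Data.List.Relation.Unary.All as All
open import Data.List.Relation.Unary.Linked as Linked using (Linked; []; [-]; _∷_)
open import Data.List.Relation.Unary.Linked.Properties using (Linked⇒All)
open import Data.List.Relation.Unary.Any using (here)
open import Data.List.Relation.Unary.AllPairs using ([]; _∷_)
open import Data.List.Relation.Unary.Unique.Propositional using (Unique)
import Data.List.Relation.Unary.Unique.Propositional.Properties as Unique
open import Data.List.Membership.Propositional using (_∈_)
open import Data.List.Membership.Propositional.Properties using (∈-++⁻; ∈-++⁺ˡ; ∈-++⁺ʳ; ∈-map⁻; ∈-map⁺)
open import Data.Product using (Σ; _×_; _,_; proj₁; proj₂)
open import Data.Sum using (_⊎_; inj₁; inj₂)
open import Data.Empty using (⊥-elim)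
open import Function using (_∘_; const; case_of_)
open import Relation.Nullary using (¬_; yes; no)
open import Relation.Nullary.Decidable using (decidable-stable)
open import Relation.Binary.PropositionalEquality
import Relation.Binary.Reasoning.Setoid


-- Shifted sequences

1+m+o≡n⇒m<n : ∀ {m n} o → suc m + o ≡ n → m < n
1+m+o≡n⇒m<n {m} o refl = m≤m+n (suc m) o

shifted-below : ∀ r {x N f} → suc r + x ≡ N → N ≤ f → x < f
shifted-below r {x} refl N≤f = <-≤-trans (s≤s (m≤n+m x r)) N≤f

module _ {A : Set} (z : A) where

  shift : ℕ → (ℕ → A) → ℕ → A
  shift zero    F N       = F N
  shift (suc d) F zero    = z
  shift (suc d) F (suc N) = shift d F N

  shift-cong-on : ∀ d {F G : ℕ → A} N → (∀ x → d + x ≡ N → F x ≡ G x) → shift d F N ≡ shift d G N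
  shift-cong-on zero    N       F≡G = F≡G N refl
  shift-cong-on (suc d) zero    F≡G = refl
  shift-cong-on (suc d) (suc N) F≡G = shift-cong-on d N (λ x eq → F≡G x (cong suc eq))

  shift-cong : ∀ d {F G : ℕ → A} → F ≗ G → shift d F ≗ shift d G
  shift-cong d F≗G N = shift-cong-on d N (λ x _ → F≗G x)

  shift-shift : ∀ a b (F : ℕ → A) → shift a (shift b F) ≗ shift (a + b) F
  shift-shift zero    b F N       = refl
  shift-shift (suc a) b F zero    = refl
  shift-shift (suc a) b F (suc N) = shift-shift a b F N

  shift-at-+ : ∀ d (F : ℕ → A) M → shift d F (d + M) ≡ F M
  shift-at-+ zero    F M = refl
  shift-at-+ (suc d) F M = shift-at-+ d F M

  shift-below : ∀ d (F : ℕ → A) {N} → N < d → shift d F N ≡ z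
  shift-below (suc d) F {zero}  _         = refl
  shift-below (suc d) F {suc N} (s≤s N<d) = shift-below d F N<d

  shift-vanishes : ∀ d (F : ℕ → A) N → (∀ M → d + M ≡ N → F M ≡ z) → shift d F N ≡ z
  shift-vanishes zero    F N       F≡z = F≡z N refl
  shift-vanishes (suc d) F zero    F≡z = refl
  shift-vanishes (suc d) F (suc N) F≡z = shift-vanishes d F N (λ M eq → F≡z M (cong suc eq))

  shift-preserves : ∀ (P : A → Set) → P z → ∀ d (F : ℕ → A) → (∀ M → P (F M)) → ∀ N → P (shift d F N)
  shift-preserves P Pz zero    F PF N       = PF N
  shift-preserves P Pz (suc d) F PF zero    = Pz
  shift-preserves P Pz (suc d) F PF (suc N) = shift-preserves P Pz d F PF N

  shift-const : ∀ d → shift d (const z) ≗ const z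
  shift-const zero    N       = refl
  shift-const (suc d) zero    = refl
  shift-const (suc d) (suc N) = shift-const d N

shift-map : ∀ {A B : Set} {z : A} {z′ : B} (h : A → B) → h z ≡ z′ →
  ∀ d (F : ℕ → A) → shift z′ d (h ∘ F) ≗ h ∘ shift z d F
shift-map h hz zero    F N       = refl
shift-map h hz (suc d) F zero    = sym hz
shift-map h hz (suc d) F (suc N) = shift-map h hz d F N

shift-map₂ : ∀ {A B C : Set} {za : A} {zb : B} {zc : C} (h : A → B → C) → h za zb ≡ zc →
  ∀ d F G → shift zc d (λ x → h (F x) (G x)) ≗ λ N → h (shift za d F N) (shift zb d G N)
shift-map₂ h hz zero    F G N       = refl
shift-map₂ h hz (suc d) F G zero    = sym hz
shift-map₂ h hz (suc d) F G (suc N) = shift-map₂ h hz d F G N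


-- Power series over ℤ

Series : Set
Series = ℕ → ℤ

infixl 6 _⊕_ _⊖_
infixr 8 q^_·_

_⊕_ _⊖_ : Series → Series → Series
(F ⊕ G) N = F N ℤ.+ G N
(F ⊖ G) N = F N ℤ.- G N

q^_·_ : ℕ → Series → Series
q^ d · F = shift 0ℤ d F

one : Series
one zero    = 1ℤ
one (suc _) = 0ℤ

⊕-cong : ∀ {F F′ G G′} → F ≗ F′ → G ≗ G′ → F ⊕ G ≗ F′ ⊕ G′
⊕-cong F≗F′ G≗G′ N = cong₂ ℤ._+_ (F≗F′ N) (G≗G′ N)

⊕-congˡ : ∀ F {G G′} → G ≗ G′ → F ⊕ G ≗ F ⊕ G′
⊕-congˡ F = ⊕-cong {F} (λ _ → refl)

⊕-congʳ : ∀ G {F F′} → F ≗ F′ → F ⊕ G ≗ F′ ⊕ G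
⊕-congʳ G F≗F′ = ⊕-cong {G = G} F≗F′ (λ _ → refl)

⊖-cong : ∀ {F F′ G G′} → F ≗ F′ → G ≗ G′ → F ⊖ G ≗ F′ ⊖ G′
⊖-cong F≗F′ G≗G′ N = cong₂ ℤ._-_ (F≗F′ N) (G≗G′ N)

q^-cong : ∀ d {F G} → F ≗ G → q^ d · F ≗ q^ d · G
q^-cong = shift-cong 0ℤ

⊖-congˡ : ∀ F {G G′} → G ≗ G′ → F ⊖ G ≗ F ⊖ G′
⊖-congˡ F = ⊖-cong {F} (λ _ → refl)

q^-q^ : ∀ a b F → q^ a · q^ b · F ≗ q^ (a + b) · F
q^-q^ = shift-shift 0ℤ

q^-q^-regroup : ∀ a b c d F → a + b ≡ c + d → q^ a · q^ b · F ≗ q^ c · q^ d · F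
q^-q^-regroup a b c d F a+b≡c+d N = begin
  (q^ a · q^ b · F) N ≡⟨ q^-q^ a b F N ⟩
  (q^ (a + b) · F) N  ≡⟨ cong (λ e → (q^ e · F) N) a+b≡c+d ⟩
  (q^ (c + d) · F) N  ≡⟨ q^-q^ c d F N ⟨
  (q^ c · q^ d · F) N ∎
  where open ≡-Reasoning

q^-distrib-⊕ : ∀ d F G → q^ d · (F ⊕ G) ≗ q^ d · F ⊕ q^ d · G
q^-distrib-⊕ = shift-map₂ ℤ._+_ refl

q^-distrib-⊖ : ∀ d F G → q^ d · (F ⊖ G) ≗ q^ d · F ⊖ q^ d · G
q^-distrib-⊖ = shift-map₂ ℤ._-_ refl

⊕-interchange : ∀ F G H K → (F ⊕ G) ⊕ (H ⊕ K) ≗ (F ⊕ H) ⊕ (G ⊕ K)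
⊕-interchange F G H K N = interchange (F N) (G N) (H N) (K N)
  where
    interchange : ∀ a b c d → (a ℤ.+ b) ℤ.+ (c ℤ.+ d) ≡ (a ℤ.+ c) ℤ.+ (b ℤ.+ d)
    interchange = ℤ-Ring.solve-∀

⊕-⊖-interchange : ∀ F G H K → (F ⊕ G) ⊖ (H ⊕ K) ≗ (F ⊖ H) ⊕ (G ⊖ K)
⊕-⊖-interchange F G H K N = interchange (F N) (G N) (H N) (K N)
  where
    interchange : ∀ a b c d → (a ℤ.+ b) ℤ.- (c ℤ.+ d) ≡ (a ℤ.- c) ℤ.+ (b ℤ.- d)
    interchange = ℤ-Ring.solve-∀

q^-one-off : ∀ d N → N ≢ d → (q^ d · one) N ≡ 0ℤ
q^-one-off zero    zero    N≢d = ⊥-elim (N≢d refl)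
q^-one-off zero    (suc N) N≢d = refl
q^-one-off (suc d) zero    N≢d = refl
q^-one-off (suc d) (suc N) N≢d = q^-one-off d N (N≢d ∘ cong suc)


module ≗-Reasoning = Relation.Binary.Reasoning.Setoid (ℕ →-setoid ℤ)


-- The series altSum and ψ

distinctGF : ℕ → ℕ → Series
distinctGF j zero    = one
distinctGF j (suc k) = distinctGF j k ⊕ q^ (j + k) · distinctGF j k

distinctGF-smallest : ∀ j k → distinctGF j (suc k) ≗ distinctGF (suc j) k ⊕ q^ j · distinctGF (suc j) k
distinctGF-smallest j zero    N = cong (λ d → one N ℤ.+ (q^ d · one) N) (+-identityʳ j)
distinctGF-smallest j (suc k) = begin
    distinctGF j (suc k) ⊕ q^ (j + suc k) · distinctGF j (suc k)
  ≈⟨ ⊕-cong (distinctGF-smallest j k) (q^-cong (j + suc k) (distinctGF-smallest j k)) ⟩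
    (A ⊕ q^ j · A) ⊕ q^ (j + suc k) · (A ⊕ q^ j · A)
  ≈⟨ ⊕-congˡ (A ⊕ q^ j · A) (q^-distrib-⊕ (j + suc k) A (q^ j · A)) ⟩
    (A ⊕ q^ j · A) ⊕ (q^ (j + suc k) · A ⊕ q^ (j + suc k) · q^ j · A)
  ≡⟨ cong (λ d → (A ⊕ q^ j · A) ⊕ (q^ d · A ⊕ q^ d · q^ j · A)) (+-suc j k) ⟩
    (A ⊕ q^ j · A) ⊕ (q^ (suc j + k) · A ⊕ q^ (suc j + k) · q^ j · A)
  ≈⟨ ⊕-congˡ (A ⊕ q^ j · A) (⊕-congˡ (q^ (suc j + k) · A) (q^-q^-regroup (suc j + k) j j (suc j + k) A (+-comm (suc j + k) j))) ⟩
    (A ⊕ q^ j · A) ⊕ (q^ (suc j + k) · A ⊕ q^ j · q^ (suc j + k) · A)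
  ≈⟨ ⊕-interchange A _ _ _ ⟩
    (A ⊕ q^ (suc j + k) · A) ⊕ (q^ j · A ⊕ q^ j · q^ (suc j + k) · A)
  ≈⟨ ⊕-congˡ (A ⊕ q^ (suc j + k) · A) (q^-distrib-⊕ j A (q^ (suc j + k) · A)) ⟨
    distinctGF (suc j) (suc k) ⊕ q^ j · distinctGF (suc j) (suc k)
  ∎
  where
    open ≗-Reasoning
    A = distinctGF (suc j) k

-- The first f terms of altSum j r k = Σ_m (-1)^m q^{r m} distinctGF j (k + m).
altSumᶠ : ℕ → ℕ → ℕ → ℕ → Series
altSumᶠ zero    j r k = const 0ℤ
altSumᶠ (suc f) j r k = distinctGF j k ⊖ q^ r · altSumᶠ f j r (suc k)

altSumᶠ-smallest : ∀ f j r k → altSumᶠ f j r (suc k) ≗ altSumᶠ f (suc j) r k ⊕ q^ j · altSumᶠ f (suc j) r k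
altSumᶠ-smallest zero    j r k N = sym (trans (ℤ.+-identityˡ _) (shift-const 0ℤ j N))
altSumᶠ-smallest (suc f) j r k = begin
    distinctGF j (suc k) ⊖ q^ r · altSumᶠ f j r (suc (suc k))
  ≈⟨ ⊖-cong (distinctGF-smallest j k) (q^-cong r (altSumᶠ-smallest f j r (suc k))) ⟩
    (B ⊕ q^ j · B) ⊖ q^ r · (C ⊕ q^ j · C)
  ≈⟨ ⊖-congˡ (B ⊕ q^ j · B) (q^-distrib-⊕ r C (q^ j · C)) ⟩
    (B ⊕ q^ j · B) ⊖ (q^ r · C ⊕ q^ r · q^ j · C)
  ≈⟨ ⊕-⊖-interchange B _ _ _ ⟩
    (B ⊖ q^ r · C) ⊕ (q^ j · B ⊖ q^ r · q^ j · C)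
  ≈⟨ ⊕-congˡ (B ⊖ q^ r · C) (⊖-congˡ (q^ j · B) (q^-q^-regroup r j j r C (+-comm r j))) ⟩
    (B ⊖ q^ r · C) ⊕ (q^ j · B ⊖ q^ j · q^ r · C)
  ≈⟨ ⊕-congˡ (B ⊖ q^ r · C) (q^-distrib-⊖ j B (q^ r · C)) ⟨
    altSumᶠ (suc f) (suc j) r k ⊕ q^ j · altSumᶠ (suc f) (suc j) r k
  ∎
  where
    open ≗-Reasoning
    B = distinctGF (suc j) k
    C = altSumᶠ f (suc j) r (suc k)

altSumᶠ-largest : ∀ f j r k → altSumᶠ f j r (suc k) ≗ altSumᶠ f j r k ⊕ q^ (j + k) · altSumᶠ f j (suc r) k
altSumᶠ-largest zero    j r k N = sym (trans (ℤ.+-identityˡ _) (shift-const 0ℤ (j + k) N))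
altSumᶠ-largest (suc f) j r k = begin
    (B ⊕ q^ (j + k) · B) ⊖ q^ r · altSumᶠ f j r (suc (suc k))
  ≈⟨ ⊖-congˡ (B ⊕ q^ (j + k) · B) (q^-cong r (altSumᶠ-largest f j r (suc k))) ⟩
    (B ⊕ q^ (j + k) · B) ⊖ q^ r · (C ⊕ q^ (j + suc k) · D)
  ≈⟨ ⊖-congˡ (B ⊕ q^ (j + k) · B) (q^-distrib-⊕ r C (q^ (j + suc k) · D)) ⟩
    (B ⊕ q^ (j + k) · B) ⊖ (q^ r · C ⊕ q^ r · q^ (j + suc k) · D)
  ≈⟨ ⊕-⊖-interchange B _ _ _ ⟩
    (B ⊖ q^ r · C) ⊕ (q^ (j + k) · B ⊖ q^ r · q^ (j + suc k) · D)
  ≈⟨ ⊕-congˡ (B ⊖ q^ r · C) (⊖-congˡ (q^ (j + k) · B) (q^-q^-regroup r (j + suc k) (j + k) (suc r) D (exponents r j k))) ⟩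
    (B ⊖ q^ r · C) ⊕ (q^ (j + k) · B ⊖ q^ (j + k) · q^ (suc r) · D)
  ≈⟨ ⊕-congˡ (B ⊖ q^ r · C) (q^-distrib-⊖ (j + k) B (q^ (suc r) · D)) ⟨
    altSumᶠ (suc f) j r k ⊕ q^ (j + k) · altSumᶠ (suc f) j (suc r) k
  ∎
  where
    open ≗-Reasoning
    B = distinctGF j k
    C = altSumᶠ f j r (suc k)
    D = altSumᶠ f j (suc r) (suc k)
    exponents : ∀ r j k → r + (j + suc k) ≡ (j + k) + suc r
    exponents = ℕ-Ring.solve-∀

altSumᶠ-irrelevant : ∀ {f f′} j r k N → N < f → N < f′ → altSumᶠ f j (suc r) k N ≡ altSumᶠ f′ j (suc r) k N
altSumᶠ-irrelevant {suc f} {suc f′} j r k N (s≤s N≤f) (s≤s N≤f′) =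
  cong (ℤ._-_ (distinctGF j k N)) (shift-cong-on 0ℤ (suc r) N (λ x eq →
    altSumᶠ-irrelevant j r (suc k) x (shifted-below r eq N≤f) (shifted-below r eq N≤f′)))

-- Only meaningful for r ≥ 1, where N + 1 terms determine the coefficient of q^N.
altSum : ℕ → ℕ → ℕ → Series
altSum j r k N = altSumᶠ (suc N) j r k N

q^-altSumᶠ : ∀ {f} d j r k N → N < f → (q^ d · altSumᶠ f j (suc r) k) N ≡ (q^ d · altSum j (suc r) k) N
q^-altSumᶠ d j r k N N<f = shift-cong-on 0ℤ d N (λ x eq →
  altSumᶠ-irrelevant j r k x (<-≤-trans (s≤s (subst (x ≤_) eq (m≤n+m x d))) N<f) ≤-refl)

altSum-unfold : ∀ j r k → altSum j (suc r) k ≗ distinctGF j k ⊖ q^ (suc r) · altSum j (suc r) (suc k)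
altSum-unfold j r k N = cong (ℤ._-_ (distinctGF j k N)) (shift-cong-on 0ℤ (suc r) N (λ x eq →
  altSumᶠ-irrelevant j r (suc k) x (shifted-below r eq ≤-refl) ≤-refl))

altSum-smallest : ∀ j r k → altSum j (suc r) (suc k) ≗ altSum (suc j) (suc r) k ⊕ q^ j · altSum (suc j) (suc r) k
altSum-smallest j r k N = trans (altSumᶠ-smallest (suc N) j (suc r) k N)
  (cong (ℤ._+_ (altSum (suc j) (suc r) k N)) (q^-altSumᶠ j (suc j) r k N ≤-refl))

altSum-largest : ∀ j r k → altSum j (suc r) (suc k) ≗ altSum j (suc r) k ⊕ q^ (j + k) · altSum j (suc (suc r)) k
altSum-largest j r k N = trans (altSumᶠ-largest (suc N) j (suc r) k N)
  (cong (ℤ._+_ (altSum j (suc r) k N)) (q^-altSumᶠ (j + k) j (suc r) k N ≤-refl))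

ψ : ℕ → Series
ψ j = altSum j j 0

ψ-recurrence : ∀ i → let j = suc i in ψ j ≗ (one ⊖ q^ j · one) ⊕ q^ (suc (3 * j)) · ψ (suc j)
ψ-recurrence i = begin
    ψ j
  ≈⟨ altSum-unfold j i 0 ⟩
    one ⊖ q^ j · altSum j j 1
  ≈⟨ ⊖-congˡ one (q^-cong j (altSum-smallest j i 0)) ⟩
    one ⊖ q^ j · (U ⊕ q^ j · U)
  ≈⟨ ⊖-congˡ one (q^-cong j ψ-tail-cancels) ⟩
    one ⊖ q^ j · (one ⊖ q^ j · W)
  ≈⟨ ⊖-congˡ one (q^-distrib-⊖ j one (q^ j · W)) ⟩
    one ⊖ (q^ j · one ⊖ q^ j · q^ j · W)
  ≈⟨ (λ N → sub-sub (one N) _ _) ⟩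
    (one ⊖ q^ j · one) ⊕ q^ j · q^ j · W
  ≈⟨ ⊕-congˡ (one ⊖ q^ j · one) (λ N → trans (q^-q^ j j W N) (q^-q^ (j + j) (suc j + 0) (ψ (suc j)) N)) ⟩
    (one ⊖ q^ j · one) ⊕ q^ (j + j + (suc j + 0)) · ψ (suc j)
  ≡⟨ cong (λ e → (one ⊖ q^ j · one) ⊕ q^ e · ψ (suc j)) (exponent j) ⟩
    (one ⊖ q^ j · one) ⊕ q^ (suc (3 * j)) · ψ (suc j)
  ∎
  where
    open ≗-Reasoning
    j = suc i
    U = altSum (suc j) j 0
    W = q^ (suc j + 0) · ψ (suc j)
    sub-sub : ∀ a b c → a ℤ.- (b ℤ.- c) ≡ (a ℤ.- b) ℤ.+ c
    sub-sub = ℤ-Ring.solve-∀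
    exponent : ∀ j → j + j + (suc j + 0) ≡ suc (3 * j)
    exponent = ℕ-Ring.solve-∀
    ψ-tail-cancels : U ⊕ q^ j · U ≗ one ⊖ q^ j · W
    ψ-tail-cancels = begin
        U ⊕ q^ j · U
      ≈⟨ ⊕-congʳ (q^ j · U) (altSum-unfold (suc j) i 0) ⟩
        (one ⊖ q^ j · altSum (suc j) j 1) ⊕ q^ j · U
      ≈⟨ ⊕-congʳ (q^ j · U) (⊖-congˡ one (q^-cong j (altSum-largest (suc j) i 0))) ⟩
        (one ⊖ q^ j · (U ⊕ W)) ⊕ q^ j · U
      ≈⟨ ⊕-congʳ (q^ j · U) (⊖-congˡ one (q^-distrib-⊕ j U W)) ⟩
        (one ⊖ (q^ j · U ⊕ q^ j · W)) ⊕ q^ j · U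
      ≈⟨ (λ N → cancel (one N) _ _) ⟩
        one ⊖ q^ j · W
      ∎
      where
        cancel : ∀ a b c → (a ℤ.- (b ℤ.+ c)) ℤ.+ b ≡ a ℤ.- c
        cancel = ℤ-Ring.solve-∀

ψ-below : ∀ i {N} → N < suc (3 * suc i) → ψ (suc i) N ≡ (one ⊖ q^ (suc i) · one) N
ψ-below i {N} N<3j+1 = begin
    ψ (suc i) N
  ≡⟨ ψ-recurrence i N ⟩
    (one ⊖ q^ (suc i) · one) N ℤ.+ (q^ (suc (3 * suc i)) · ψ (suc (suc i))) N
  ≡⟨ cong (ℤ._+_ ((one ⊖ q^ (suc i) · one) N)) (shift-below 0ℤ (suc (3 * suc i)) (ψ (suc (suc i))) N<3j+1) ⟩
    (one ⊖ q^ (suc i) · one) N ℤ.+ 0ℤ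
  ≡⟨ ℤ.+-identityʳ _ ⟩
    (one ⊖ q^ (suc i) · one) N
  ∎
  where open ≡-Reasoning

ψ-at-0 : ∀ i → ψ (suc i) 0 ≡ 1ℤ
ψ-at-0 i = ψ-below i (s≤s z≤n)

ψ-at-index : ∀ i → ψ (suc i) (suc i) ≡ -1ℤ
ψ-at-index i = trans (ψ-below i (s≤s (s≤s (m≤m+n i _))))
  (cong (ℤ._-_ 0ℤ) (trans (cong (q^ suc i · one) (sym (+-identityʳ (suc i)))) (shift-at-+ 0ℤ (suc i) one 0)))

ψ-gap : ∀ i {x} → suc x ≢ suc i → suc x < suc (3 * suc i) → ψ (suc i) (suc x) ≡ 0ℤ
ψ-gap i x≢i x<3j+1 = trans (ψ-below i x<3j+1) (cong (ℤ._-_ 0ℤ) (q^-one-off (suc i) _ x≢i))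

ψ-step : ∀ i y → ψ (suc i) (suc (3 * suc i) + y) ≡ ψ (suc (suc i)) y
ψ-step i y = begin
    ψ (suc i) (N + y)
  ≡⟨ ψ-recurrence i (N + y) ⟩
    (0ℤ ℤ.- (q^ suc i · one) (N + y)) ℤ.+ (q^ N · ψ (suc (suc i))) (N + y)
  ≡⟨ cong₂ (λ u v → (0ℤ ℤ.- u) ℤ.+ v)
       (trans (cong (q^ suc i · one) (split (suc i) y)) (shift-at-+ 0ℤ (suc i) one _))
       (shift-at-+ 0ℤ N (ψ (suc (suc i))) y) ⟩
    0ℤ ℤ.+ ψ (suc (suc i)) y
  ≡⟨ ℤ.+-identityˡ _ ⟩
    ψ (suc (suc i)) y
  ∎
  where
    open ≡-Reasoning
    N = suc (3 * suc i)
    split : ∀ j y → suc (3 * j) + y ≡ j + suc (2 * j + y)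
    split = ℕ-Ring.solve-∀

ψExponent : ℕ → ℕ → ℕ
ψExponent j zero    = 0
ψExponent j (suc k) = suc (3 * j) + ψExponent (suc j) k

ψ-shift : ∀ i k x → ψ (suc i) (ψExponent (suc i) k + x) ≡ ψ (suc i + k) x
ψ-shift i zero    x = cong (λ j → ψ j x) (sym (+-identityʳ (suc i)))
ψ-shift i (suc k) x = begin
    ψ (suc i) (suc (3 * suc i) + ψExponent (suc (suc i)) k + x)
  ≡⟨ cong (ψ (suc i)) (+-assoc (suc (3 * suc i)) (ψExponent (suc (suc i)) k) x) ⟩
    ψ (suc i) (suc (3 * suc i) + (ψExponent (suc (suc i)) k + x))
  ≡⟨ ψ-step i _ ⟩
    ψ (suc (suc i)) (ψExponent (suc (suc i)) k + x)
  ≡⟨ ψ-shift (suc i) k x ⟩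
    ψ (suc (suc i) + k) x
  ≡⟨ cong (λ j → ψ j x) (+-suc (suc i) k) ⟨
    ψ (suc i + suc k) x
  ∎
  where open ≡-Reasoning

ψ-support : ∀ i N → ψ (suc i) N ≢ 0ℤ →
  Σ ℕ λ k → N ≡ ψExponent (suc i) k ⊎ N ≡ ψExponent (suc i) k + (suc i + k)
ψ-support i N = bounded (suc N) i N ≤-refl
  where
    regroup : ∀ a b i k → a + (b + (suc (suc i) + k)) ≡ (a + b) + (suc i + suc k)
    regroup = ℕ-Ring.solve-∀
    bounded : ∀ B i N → N < B → ψ (suc i) N ≢ 0ℤ →
      Σ ℕ λ k → N ≡ ψExponent (suc i) k ⊎ N ≡ ψExponent (suc i) k + (suc i + k)
    bounded B i zero _ _ = 0 , inj₁ refl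
    bounded B i (suc x) _ _ with suc x ≟ suc i
    ... | yes refl = 0 , inj₂ (cong suc (sym (+-identityʳ x)))
    bounded B i (suc x) x<B ψ≢0 | no x≢i with suc x <? suc (3 * suc i)
    ... | yes below = ⊥-elim (ψ≢0 (ψ-gap i x≢i below))
    bounded (suc B) i (suc x) (s≤s x≤B) ψ≢0 | no _ | no ¬below
      with y , refl ← m≤n⇒∃[o]m+o≡n (≮⇒≥ ¬below)
      with bounded B (suc i) y (<-≤-trans (s≤s (m≤n+m y _)) x≤B) (ψ≢0 ∘ trans (ψ-step i y))
    ... | k , inj₁ y≡e = suc k , inj₁ (cong (suc (3 * suc i) +_) y≡e)
    ... | k , inj₂ y≡e = suc k , inj₂ (trans (cong (suc (3 * suc i) +_) y≡e) (regroup (suc (3 * suc i)) _ i k))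

butterflySeries : Series
butterflySeries = q^ 9 · altSum 2 3 0

butterflySeries-ψ : butterflySeries ≗ q^ 9 · one ⊖ q^ 12 · ψ 3 ⊖ q^ 14 · ψ 3
butterflySeries-ψ = begin
    q^ 9 · altSum 2 3 0
  ≈⟨ q^-cong 9 (altSum-unfold 2 2 0) ⟩
    q^ 9 · (one ⊖ q^ 3 · altSum 2 3 1)
  ≈⟨ q^-cong 9 (⊖-congˡ one (q^-cong 3 (altSum-smallest 2 2 0))) ⟩
    q^ 9 · (one ⊖ q^ 3 · (ψ 3 ⊕ q^ 2 · ψ 3))
  ≈⟨ q^-distrib-⊖ 9 one _ ⟩
    q^ 9 · one ⊖ q^ 9 · q^ 3 · (ψ 3 ⊕ q^ 2 · ψ 3)
  ≈⟨ ⊖-congˡ (q^ 9 · one) (λ N → trans (q^-q^ 9 3 _ N) (q^-distrib-⊕ 12 (ψ 3) (q^ 2 · ψ 3) N)) ⟩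
    q^ 9 · one ⊖ (q^ 12 · ψ 3 ⊕ q^ 12 · q^ 2 · ψ 3)
  ≈⟨ ⊖-congˡ (q^ 9 · one) (⊕-congˡ (q^ 12 · ψ 3) (q^-q^ 12 2 (ψ 3))) ⟩
    q^ 9 · one ⊖ (q^ 12 · ψ 3 ⊕ q^ 14 · ψ 3)
  ≈⟨ (λ N → sub-add ((q^ 9 · one) N) ((q^ 12 · ψ 3) N) _) ⟩
    q^ 9 · one ⊖ q^ 12 · ψ 3 ⊖ q^ 14 · ψ 3
  ∎
  where
    open ≗-Reasoning
    sub-add : ∀ a b c → a ℤ.- (b ℤ.+ c) ≡ a ℤ.- b ℤ.- c
    sub-add = ℤ-Ring.solve-∀


-- Enumerating butterfly partitions

module _ {A : Set} where

  ∈-shift⁻ : ∀ d (F : ℕ → List A) N {x} → x ∈ shift [] d F N → Σ ℕ λ M → d + M ≡ N × x ∈ F M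
  ∈-shift⁻ zero    F N       x∈ = N , refl , x∈
  ∈-shift⁻ (suc d) F (suc N) x∈ with M , refl , x∈F ← ∈-shift⁻ d F N x∈ = M , refl , x∈F

  ∈-shift⁺ : ∀ d (F : ℕ → List A) M {x} → x ∈ F M → x ∈ shift [] d F (d + M)
  ∈-shift⁺ d F M = subst (_ ∈_) (sym (shift-at-+ [] d F M))

  lengthℤ : List A → ℤ
  lengthℤ xs = ℤ.+ length xs

  lengthℤ-++ : ∀ (xs ys : List A) → lengthℤ (xs ++ ys) ≡ lengthℤ xs ℤ.+ lengthℤ ys
  lengthℤ-++ xs ys = cong ℤ.+_ (length-++ xs)

  lengthℤ-shift : ∀ d (F : ℕ → List A) → lengthℤ ∘ shift [] d F ≗ q^ d · (lengthℤ ∘ F)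
  lengthℤ-shift d F N = sym (shift-map lengthℤ refl d F N)

DistinctPartitionIn : ℕ → ℕ → ℕ → List ℕ → Set
DistinctPartitionIn lo hi s ps = DistinctPartition s ps × All (lo ≤_) ps × All (_< hi) ps

distinctPartitions : ℕ → ℕ → ℕ → List (List ℕ)
distinctPartitions lo zero      zero    = [] ∷ []
distinctPartitions lo zero      (suc s) = []
distinctPartitions lo (suc len) s       =
  distinctPartitions lo len s ++ shift [] (lo + len) (map (lo + len ∷_) ∘ distinctPartitions lo len) s

lengthℤ-distinctPartitions : ∀ lo len → lengthℤ ∘ distinctPartitions lo len ≗ distinctGF lo len
lengthℤ-distinctPartitions lo zero      zero    = refl
lengthℤ-distinctPartitions lo zero      (suc s) = refl
lengthℤ-distinctPartitions lo (suc len) s       = begin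
    lengthℤ (D s ++ shift [] (lo + len) G s)
  ≡⟨ lengthℤ-++ (D s) _ ⟩
    lengthℤ (D s) ℤ.+ lengthℤ (shift [] (lo + len) G s)
  ≡⟨ cong₂ ℤ._+_ (lengthℤ-distinctPartitions lo len s) (lengthℤ-shift (lo + len) G s) ⟩
    distinctGF lo len s ℤ.+ (q^ (lo + len) · (lengthℤ ∘ G)) s
  ≡⟨ cong (ℤ._+_ (distinctGF lo len s)) (q^-cong (lo + len) lengthℤ-G s) ⟩
    distinctGF lo (suc len) s
  ∎
  where
    open ≡-Reasoning
    D = distinctPartitions lo len
    G = map (lo + len ∷_) ∘ D
    lengthℤ-G : lengthℤ ∘ G ≗ distinctGF lo len
    lengthℤ-G x = trans (cong ℤ.+_ (length-map _ (D x))) (lengthℤ-distinctPartitions lo len x)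

linked⇒below-head : ∀ {x qs} → Linked _>_ (x ∷ qs) → All (_< x) qs
linked⇒below-head [-]             = []
linked⇒below-head (x>y ∷ linked) = Linked⇒All (λ p q → <-trans q p) x>y linked

below-head⇒linked : ∀ {x qs} → All (_< x) qs → Linked _>_ qs → Linked _>_ (x ∷ qs)
below-head⇒linked []         _      = [-]
below-head⇒linked (y<x ∷ _) linked = y<x ∷ linked

distinctPartitions-sound : ∀ lo len s ps → ps ∈ distinctPartitions lo len s → DistinctPartitionIn lo (lo + len) s ps
distinctPartitions-sound lo zero      zero    [] (here refl) = ([] , refl) , [] , []
distinctPartitions-sound lo (suc len) s       ps ps∈ with ∈-++⁻ (distinctPartitions lo len s) ps∈
... | inj₁ ps∈old with (linked , sum≡) , lo≤ , <hi ← distinctPartitions-sound lo len s ps ps∈old =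
  (linked , sum≡) , lo≤ , All.map (λ p → <-≤-trans p (≤-trans (n≤1+n _) (≤-reflexive (sym (+-suc lo len))))) <hi
... | inj₂ ps∈new with M , refl , ps∈map ← ∈-shift⁻ (lo + len) _ s ps∈new
                  with qs , qs∈ , refl ← ∈-map⁻ _ ps∈map
                  with (linked , refl) , lo≤ , <hi ← distinctPartitions-sound lo len M qs qs∈ =
  (below-head⇒linked <hi linked , refl) ,
  (m≤m+n lo len ∷ lo≤) ,
  (≤-reflexive (sym (+-suc lo len)) ∷ All.map (λ p → <-trans p (≤-reflexive (sym (+-suc lo len)))) <hi)

[]∈distinctPartitions : ∀ lo len → [] ∈ distinctPartitions lo len 0
[]∈distinctPartitions lo zero      = here refl
[]∈distinctPartitions lo (suc len) = ∈-++⁺ˡ ([]∈distinctPartitions lo len)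

distinctPartitions-complete : ∀ lo len s ps → DistinctPartitionIn lo (lo + len) s ps → ps ∈ distinctPartitions lo len s
distinctPartitions-complete lo len s [] ((_ , refl) , _) = []∈distinctPartitions lo len
distinctPartitions-complete lo zero s (x ∷ qs) (_ , lo≤x ∷ _ , x<lo+0 ∷ _) =
  ⊥-elim (<-irrefl refl (<-≤-trans x<lo+0 (≤-trans (≤-reflexive (+-identityʳ lo)) lo≤x)))
distinctPartitions-complete lo (suc len) s (x ∷ qs) ((linked , sum≡) , lo≤x ∷ lo≤ , x<hi ∷ <hi)
  with m≤n⇒m<n∨m≡n (≤-pred (≤-trans x<hi (≤-reflexive (+-suc lo len))))
... | inj₁ x<lo+len = ∈-++⁺ˡ (distinctPartitions-complete lo len s (x ∷ qs)
        ((linked , sum≡) , lo≤x ∷ lo≤ , x<lo+len ∷ All.map (λ p → <-trans p x<lo+len) (linked⇒below-head linked)))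
... | inj₂ refl = ∈-++⁺ʳ (distinctPartitions lo len s)
        (subst (λ t → x ∷ qs ∈ shift [] x (map (x ∷_) ∘ distinctPartitions lo len) t) sum≡
          (∈-shift⁺ x _ (sum qs) (∈-map⁺ (x ∷_) (distinctPartitions-complete lo len (sum qs) qs
            ((Linked.tail linked , refl) , lo≤ , linked⇒below-head linked)))))

distinctPartitions-unique : ∀ lo len s → Unique (distinctPartitions lo len s)
distinctPartitions-unique lo zero      zero    = [] ∷ []
distinctPartitions-unique lo zero      (suc s) = []
distinctPartitions-unique lo (suc len) s       = Unique.++⁺ (distinctPartitions-unique lo len s)
  (shift-preserves [] Unique [] (lo + len) _ (λ M → Unique.map⁺ ∷-injectiveʳ (distinctPartitions-unique lo len M)) s)
  disjoint
  where
    disjoint : ∀ {v} → ¬ (v ∈ distinctPartitions lo len s × v ∈ shift [] (lo + len) (map (lo + len ∷_) ∘ distinctPartitions lo len) s)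
    disjoint (v∈old , v∈new)
      with M , _ , v∈map ← ∈-shift⁻ (lo + len) _ s v∈new
      with qs , _ , refl ← ∈-map⁻ _ v∈map
      with _ , _ , head<lo+len ∷ _ ← distinctPartitions-sound lo len s _ v∈old = <-irrefl refl head<lo+len

∈-if⁻ : ∀ {A : Set} b {xs : List A} {x} → x ∈ (if b then xs else []) → b ≡ true × x ∈ xs
∈-if⁻ true x∈ = refl , x∈

∈-if⁺ : ∀ {A : Set} {b} {xs : List A} {x} → b ≡ true → x ∈ xs → x ∈ (if b then xs else [])
∈-if⁺ refl x∈ = x∈

butterfly : ℕ → List ℕ → List ℕ
butterfly k S = 4 + k ∷ 3 + k ∷ 2 + k ∷ S

butterflyBlock : (ℕ → Bool) → ℕ → ℕ → List (List ℕ)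
butterflyBlock P k N = if P (3 + k) then map (butterfly k) (distinctPartitions 2 k N) else []

-- The butterfly partitions of 9 + 3k + N with p₂ ≥ k + 3 and P p₂, by increasing p₂.
butterfliesFrom : (ℕ → Bool) → ℕ → ℕ → List (List ℕ)
butterfliesFrom P k 0                   = butterflyBlock P k 0
butterfliesFrom P k 1                   = butterflyBlock P k 1
butterfliesFrom P k 2                   = butterflyBlock P k 2
butterfliesFrom P k (suc (suc (suc N))) = butterflyBlock P k (3 + N) ++ butterfliesFrom P (suc k) N

butterfliesFrom-unfold : ∀ P k N → butterfliesFrom P k N ≡ butterflyBlock P k N ++ shift [] 3 (butterfliesFrom P (suc k)) N
butterfliesFrom-unfold P k 0                   = sym (++-identityʳ _)
butterfliesFrom-unfold P k 1                   = sym (++-identityʳ _)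
butterfliesFrom-unfold P k 2                   = sym (++-identityʳ _)
butterfliesFrom-unfold P k (suc (suc (suc N))) = refl

even : ℕ → Bool
even zero    = true
even (suc n) = not (even n)

odd : ℕ → Bool
odd n = not (even n)

even-reflects : ∀ n → Reflects (2 ∣ n) (even n)
even-reflects 0             = ofʸ (divides 0 refl)
even-reflects 1             = ofⁿ (λ 2∣1 → case ∣1⇒≡1 2∣1 of λ ())
even-reflects (suc (suc n)) = subst (Reflects (2 ∣ 2 + n)) (sym (not-involutive (even n))) (step (even-reflects n))
  where
    step : ∀ {b} → Reflects (2 ∣ n) b → Reflects (2 ∣ 2 + n) b
    step (ofʸ 2∣n) = ofʸ (∣m∣n⇒∣m+n ∣-refl 2∣n)
    step (ofⁿ 2∤n) = ofⁿ (λ 2∣2+n → 2∤n (∣m+n∣m⇒∣n 2∣2+n ∣-refl))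

signOf : Bool → ℤ
signOf true  = 1ℤ
signOf false = -1ℤ

count : (ℕ → Bool) → ℕ → Series
count P k = lengthℤ ∘ butterfliesFrom P k

count-unfold : ∀ P k N → count P k N ≡ lengthℤ (butterflyBlock P k N) ℤ.+ (q^ 3 · count P (suc k)) N
count-unfold P k N = begin
    lengthℤ (butterfliesFrom P k N)
  ≡⟨ cong lengthℤ (butterfliesFrom-unfold P k N) ⟩
    lengthℤ (butterflyBlock P k N ++ shift [] 3 (butterfliesFrom P (suc k)) N)
  ≡⟨ lengthℤ-++ (butterflyBlock P k N) _ ⟩
    lengthℤ (butterflyBlock P k N) ℤ.+ lengthℤ (shift [] 3 (butterfliesFrom P (suc k)) N)
  ≡⟨ cong (ℤ._+_ (lengthℤ (butterflyBlock P k N))) (lengthℤ-shift 3 (butterfliesFrom P (suc k)) N) ⟩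
    lengthℤ (butterflyBlock P k N) ℤ.+ (q^ 3 · count P (suc k)) N
  ∎
  where open ≡-Reasoning

-- The sign at k + 1 unfolds to signOf (not (not b)), which is signOf b only once b is a constructor.
block-difference : ∀ b (xs : List (List ℕ)) C S → lengthℤ xs ≡ C →
  (lengthℤ (if not b then xs else []) ℤ.- lengthℤ (if b then xs else [])) ℤ.+ signOf (not (not b)) ℤ.* S
    ≡ signOf (not b) ℤ.* (C ℤ.- S)
block-difference true  xs C S refl = identity (lengthℤ xs) S
  where
    identity : ∀ c s → (0ℤ ℤ.- c) ℤ.+ 1ℤ ℤ.* s ≡ -1ℤ ℤ.* (c ℤ.- s)
    identity = ℤ-Ring.solve-∀
block-difference false xs C S refl = identity (lengthℤ xs) S
  where
    identity : ∀ c s → (c ℤ.- 0ℤ) ℤ.+ -1ℤ ℤ.* s ≡ 1ℤ ℤ.* (c ℤ.- s)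
    identity = ℤ-Ring.solve-∀

count-difference : ∀ k N → (count odd k ⊖ count even k) N ≡ signOf (odd (3 + k)) ℤ.* altSum 2 3 k N
count-difference k N = bounded (suc N) k N ≤-refl
  where
    rearrange : ∀ a b c d → (a ℤ.+ b) ℤ.- (c ℤ.+ d) ≡ (a ℤ.- c) ℤ.+ (b ℤ.- d)
    rearrange = ℤ-Ring.solve-∀
    bounded : ∀ B k N → N < B → (count odd k ⊖ count even k) N ≡ signOf (odd (3 + k)) ℤ.* altSum 2 3 k N
    bounded (suc B) k N (s≤s N≤B) = begin
        count odd k N ℤ.- count even k N
      ≡⟨ cong₂ ℤ._-_ (count-unfold odd k N) (count-unfold even k N) ⟩
        (lengthℤ (butterflyBlock odd k N) ℤ.+ (q^ 3 · count odd (suc k)) N)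
          ℤ.- (lengthℤ (butterflyBlock even k N) ℤ.+ (q^ 3 · count even (suc k)) N)
      ≡⟨ rearrange (lengthℤ (butterflyBlock odd k N)) ((q^ 3 · count odd (suc k)) N) (lengthℤ (butterflyBlock even k N)) _ ⟩
        blocks ℤ.+ ((q^ 3 · count odd (suc k)) N ℤ.- (q^ 3 · count even (suc k)) N)
      ≡⟨ cong (ℤ._+_ blocks) (q^-distrib-⊖ 3 (count odd (suc k)) (count even (suc k)) N) ⟨
        blocks ℤ.+ (q^ 3 · (count odd (suc k) ⊖ count even (suc k))) N
      ≡⟨ cong (ℤ._+_ blocks) (shift-cong-on 0ℤ 3 N (λ x 3+x≡N →
           bounded B (suc k) x (shifted-below 2 3+x≡N N≤B))) ⟩
        blocks ℤ.+ (q^ 3 · (λ x → σ′ ℤ.* altSum 2 3 (suc k) x)) N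
      ≡⟨ cong (ℤ._+_ blocks) (shift-map (ℤ._*_ σ′) (ℤ.*-zeroʳ σ′) 3 (altSum 2 3 (suc k)) N) ⟩
        blocks ℤ.+ σ′ ℤ.* (q^ 3 · altSum 2 3 (suc k)) N
      ≡⟨ block-difference (even (3 + k)) (map (butterfly k) (distinctPartitions 2 k N)) (distinctGF 2 k N) _
           (trans (cong ℤ.+_ (length-map _ (distinctPartitions 2 k N))) (lengthℤ-distinctPartitions 2 k N)) ⟩
        σ ℤ.* (distinctGF 2 k N ℤ.- (q^ 3 · altSum 2 3 (suc k)) N)
      ≡⟨ cong (ℤ._*_ σ) (altSum-unfold 2 2 k N) ⟨
        σ ℤ.* altSum 2 3 k N
      ∎
      where
        open ≡-Reasoning
        σ = signOf (odd (3 + k))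
        σ′ = signOf (odd (3 + suc k))
        blocks = lengthℤ (butterflyBlock odd k N) ℤ.- lengthℤ (butterflyBlock even k N)

∈-butterfliesFrom⁻ : ∀ P k N {ps} → ps ∈ butterfliesFrom P k N →
  Σ ℕ λ k′ → Σ ℕ λ M → k ≤ k′ × 3 * k + N ≡ 3 * k′ + M × ps ∈ butterflyBlock P k′ M
∈-butterfliesFrom⁻ P k 0 ps∈ = k , 0 , ≤-refl , refl , ps∈
∈-butterfliesFrom⁻ P k 1 ps∈ = k , 1 , ≤-refl , refl , ps∈
∈-butterfliesFrom⁻ P k 2 ps∈ = k , 2 , ≤-refl , refl , ps∈
∈-butterfliesFrom⁻ P k (suc (suc (suc N))) ps∈ with ∈-++⁻ (butterflyBlock P k (3 + N)) ps∈
... | inj₁ ps∈block = k , 3 + N , ≤-refl , refl , ps∈block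
... | inj₂ ps∈rest with k′ , M , k<k′ , eq , ps∈block ← ∈-butterfliesFrom⁻ P (suc k) N ps∈rest =
  k′ , M , <⇒≤ k<k′ , trans (regroup k N) eq , ps∈block
  where
    regroup : ∀ k N → 3 * k + (3 + N) ≡ 3 * suc k + N
    regroup = ℕ-Ring.solve-∀

∈-butterfliesFrom⁺ : ∀ P k d M {ps} → ps ∈ butterflyBlock P (k + d) M → ps ∈ butterfliesFrom P k (3 * d + M)
∈-butterfliesFrom⁺ P k zero    M {ps} ps∈ =
  subst (ps ∈_) (sym (butterfliesFrom-unfold P k M)) (∈-++⁺ˡ (subst (λ k′ → ps ∈ butterflyBlock P k′ M) (+-identityʳ k) ps∈))
∈-butterfliesFrom⁺ P k (suc d) M {ps} ps∈ =
  subst (λ N → ps ∈ butterfliesFrom P k N) (sym (regroup d M))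
    (∈-++⁺ʳ (butterflyBlock P k _) (∈-butterfliesFrom⁺ P (suc k) d M (subst (λ k′ → ps ∈ butterflyBlock P k′ M) (+-suc k d) ps∈)))
  where
    regroup : ∀ d M → 3 * suc d + M ≡ 3 + (3 * d + M)
    regroup = ℕ-Ring.solve-∀

∈-butterflyBlock⇒shape : ∀ P k N {ps} → ps ∈ butterflyBlock P k N → Σ (List ℕ) λ S → ps ≡ butterfly k S
∈-butterflyBlock⇒shape P k N ps∈ with S , _ , ps≡ ← ∈-map⁻ _ (proj₂ (∈-if⁻ (P (3 + k)) ps∈)) = S , ps≡

butterflyBlock-unique : ∀ P k N → Unique (butterflyBlock P k N)
butterflyBlock-unique P k N with P (3 + k)
... | true  = Unique.map⁺ (∷-injectiveʳ ∘ ∷-injectiveʳ ∘ ∷-injectiveʳ) (distinctPartitions-unique 2 k N)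
... | false = []

butterfliesFrom-unique : ∀ P k N → Unique (butterfliesFrom P k N)
butterfliesFrom-unique P k 0 = butterflyBlock-unique P k 0
butterfliesFrom-unique P k 1 = butterflyBlock-unique P k 1
butterfliesFrom-unique P k 2 = butterflyBlock-unique P k 2
butterfliesFrom-unique P k (suc (suc (suc N))) =
  Unique.++⁺ (butterflyBlock-unique P k (3 + N)) (butterfliesFrom-unique P (suc k) N) disjoint
  where
    disjoint : ∀ {ps} → ¬ (ps ∈ butterflyBlock P k (3 + N) × ps ∈ butterfliesFrom P (suc k) N)
    disjoint (ps∈block , ps∈rest)
      with k′ , M , k<k′ , _ , ps∈block′ ← ∈-butterfliesFrom⁻ P (suc k) N ps∈rest
      with S , refl ← ∈-butterflyBlock⇒shape P k _ ps∈block
      with S′ , ps≡ ← ∈-butterflyBlock⇒shape P k′ M ps∈block′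
      = <-irrefl (suc-injective (suc-injective (suc-injective (suc-injective (∷-injectiveˡ ps≡))))) k<k′

butterflies : (ℕ → Bool) → ℕ → List (List ℕ)
butterflies P = shift [] 9 (butterfliesFrom P 0)

butterflies-unique : ∀ P n → Unique (butterflies P n)
butterflies-unique P = shift-preserves [] Unique [] 9 (butterfliesFrom P 0) (butterfliesFrom-unique P 0)

butterfly-isButterfly : ∀ k S M → DistinctPartitionIn 2 (2 + k) M S →
  ButterflyWithSecond (9 + (3 * k + M)) (3 + k) (butterfly k S)
butterfly-isButterfly k S M ((linked , refl) , 2≤S , S<2+k) =
  (n<1+n _ ∷ n<1+n _ ∷ below-head⇒linked S<2+k linked , regroup k (sum S)) ,
  (s≤s (s≤s z≤n) ∷ s≤s (s≤s z≤n) ∷ s≤s (s≤s z≤n) ∷ 2≤S) ,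
  _ , _ , S , refl , refl , refl
  where
    regroup : ∀ k s → 4 + k + (3 + k + (2 + k + s)) ≡ 9 + (3 * k + s)
    regroup = ℕ-Ring.solve-∀

∈-butterflies : ∀ {P : ℕ → Bool} {Q : ℕ → Set} → (∀ m → Reflects (Q m) (P m)) →
  ∀ n ps → ps ∈ butterflies P n ⇔ Σ ℕ (λ p₂ → ButterflyWithSecond n p₂ ps × Q p₂)
∈-butterflies {P} {Q} reflects n ps = mk⇔ sound complete
  where
    sound : ps ∈ butterflies P n → Σ ℕ (λ p₂ → ButterflyWithSecond n p₂ ps × Q p₂)
    sound ps∈
      with N , refl , ps∈′ ← ∈-shift⁻ 9 _ n ps∈
      with k , M , _ , refl , ps∈block ← ∈-butterfliesFrom⁻ P 0 N ps∈′
      with Pk , ps∈map ← ∈-if⁻ (P (3 + k)) ps∈block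
      with S , S∈ , refl ← ∈-map⁻ _ ps∈map
      = 3 + k , butterfly-isButterfly k S M (distinctPartitions-sound 2 k M S S∈) ,
        invert (subst (Reflects (Q (3 + k))) Pk (reflects (3 + k)))
    complete : Σ ℕ (λ p₂ → ButterflyWithSecond n p₂ ps × Q p₂) → ps ∈ butterflies P n
    complete (_ , ((linked , sum≡) , (_ ∷ _ ∷ s≤s (s≤s (z≤n {k})) ∷ 2≤rest) , _ , _ , rest , refl , refl , refl) , q) =
      subst (λ t → ps ∈ butterflies P t) (trans (sym (regroup k (sum rest))) sum≡)
        (∈-shift⁺ 9 (butterfliesFrom P 0) (3 * k + sum rest) (∈-butterfliesFrom⁺ P 0 k (sum rest)
          (∈-if⁺ (det (reflects (3 + k)) (ofʸ q)) (∈-map⁺ (butterfly k) (distinctPartitions-complete 2 k (sum rest) rest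
            ((Linked.tail (Linked.tail (Linked.tail linked)) , refl) , 2≤rest ,
             linked⇒below-head (Linked.tail (Linked.tail linked))))))))
      where
        regroup : ∀ k s → 4 + k + (3 + k + (2 + k + s)) ≡ 9 + (3 * k + s)
        regroup = ℕ-Ring.solve-∀

butterflies-difference : ∀ n → lengthℤ (butterflies odd n) ℤ.- lengthℤ (butterflies even n) ≡ butterflySeries n
butterflies-difference n = begin
    lengthℤ (butterflies odd n) ℤ.- lengthℤ (butterflies even n)
  ≡⟨ cong₂ ℤ._-_ (lengthℤ-shift 9 (butterfliesFrom odd 0) n) (lengthℤ-shift 9 (butterfliesFrom even 0) n) ⟩
    (q^ 9 · count odd 0) n ℤ.- (q^ 9 · count even 0) n
  ≡⟨ q^-distrib-⊖ 9 (count odd 0) (count even 0) n ⟨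
    (q^ 9 · (count odd 0 ⊖ count even 0)) n
  ≡⟨ q^-cong 9 (λ N → trans (count-difference 0 N) (ℤ.*-identityˡ _)) n ⟩
    butterflySeries n
  ∎
  where open ≡-Reasoning


-- The exceptional forms

ψExponent-closed : ∀ j k → 2 * ψExponent j k + k ≡ 3 * k * k + 6 * j * k
ψExponent-closed j zero    = sym (*-zeroʳ (6 * j))
ψExponent-closed j (suc k) = begin
    2 * (suc (3 * j) + ψExponent (suc j) k) + suc k
  ≡⟨ expand j (ψExponent (suc j) k) k ⟩
    (2 * ψExponent (suc j) k + k) + (3 + 6 * j)
  ≡⟨ cong (_+ (3 + 6 * j)) (ψExponent-closed (suc j) k) ⟩
    (3 * k * k + 6 * suc j * k) + (3 + 6 * j)
  ≡⟨ collect j k ⟩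
    3 * suc k * suc k + 6 * j * suc k
  ∎
  where
    open ≡-Reasoning
    expand : ∀ j E k → 2 * (suc (3 * j) + E) + suc k ≡ (2 * E + k) + (3 + 6 * j)
    expand = ℕ-Ring.solve-∀
    collect : ∀ j k → (3 * k * k + 6 * suc j * k) + (3 + 6 * j) ≡ 3 * suc k * suc k + 6 * j * suc k
    collect = ℕ-Ring.solve-∀

ψExponent-suc : ∀ j k → ψExponent j (suc k) ≡ ψExponent j k + suc (3 * (j + k))
ψExponent-suc j zero    = trans (+-identityʳ _) (cong (λ i → suc (3 * i)) (sym (+-identityʳ j)))
ψExponent-suc j (suc k) = begin
    suc (3 * j) + ψExponent (suc j) (suc k)
  ≡⟨ cong (suc (3 * j) +_) (ψExponent-suc (suc j) k) ⟩
    suc (3 * j) + (ψExponent (suc j) k + suc (3 * (suc j + k)))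
  ≡⟨ +-assoc (suc (3 * j)) _ _ ⟨
    ψExponent j (suc k) + suc (3 * (suc j + k))
  ≡⟨ cong (λ i → ψExponent j (suc k) + suc (3 * i)) (+-suc j k) ⟨
    ψExponent j (suc k) + suc (3 * (j + suc k))
  ∎
  where open ≡-Reasoning

form1-point : ∀ k → Form1 (3 + k) (14 + (ψExponent 3 k + (3 + k)))
form1-point k = trans (expand k (ψExponent 3 k)) (trans (cong (_+ (34 + k)) (ψExponent-closed 3 k)) (collect k))
  where
    expand : ∀ k E → 2 * (14 + (E + (3 + k))) ≡ (2 * E + k) + (34 + k)
    expand = ℕ-Ring.solve-∀
    collect : ∀ k → (3 * k * k + 6 * 3 * k) + (34 + k) ≡ 3 * ((3 + k) * ((3 + k) * 1)) + (3 + k) + 4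
    collect = ℕ-Ring.solve-∀

form2-point : ∀ k → Form2 (2 + k) (12 + ψExponent 3 k)
form2-point k = trans (expand k (ψExponent 3 k)) (trans (cong (_+ 27) (ψExponent-closed 3 k)) (collect k))
  where
    expand : ∀ k E → 2 * (12 + E) + (2 + k) + 1 ≡ (2 * E + k) + 27
    expand = ℕ-Ring.solve-∀
    collect : ∀ k → (3 * k * k + 6 * 3 * k) + 27 ≡ 3 * ((2 + k + 1) * ((2 + k + 1) * 1))
    collect = ℕ-Ring.solve-∀

form3-point : ∀ k → Form3 (2 + k) (14 + ψExponent 3 k)
form3-point k = trans (expand k (ψExponent 3 k)) (trans (cong (_+ 30) (ψExponent-closed 3 k)) (collect k))
  where
    expand : ∀ k E → 2 * (14 + E) + (2 + k) ≡ (2 * E + k) + 30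
    expand = ℕ-Ring.solve-∀
    collect : ∀ k → (3 * k * k + 6 * 3 * k) + 30 ≡ 3 * ((2 + k + 1) * ((2 + k + 1) * 1)) + 3
    collect = ℕ-Ring.solve-∀

form4-point : ∀ k → Form4 (2 + k) (12 + (ψExponent 3 k + (3 + k)))
form4-point k = trans (expand k (ψExponent 3 k)) (trans (cong (_+ (30 + k)) (ψExponent-closed 3 k)) (collect k))
  where
    expand : ∀ k E → 2 * (12 + (E + (3 + k))) ≡ (2 * E + k) + (30 + k)
    expand = ℕ-Ring.solve-∀
    collect : ∀ k → (3 * k * k + 6 * 3 * k) + (30 + k) ≡ 3 * ((2 + k + 1) * ((2 + k + 1) * 1)) + (2 + k) + 1
    collect = ℕ-Ring.solve-∀

Form1-injective : ∀ t n m → Form1 t n → Form1 t m → n ≡ m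
Form1-injective t n m f f′ = *-cancelˡ-≡ n m 2 (trans f (sym f′))

Form2-injective : ∀ t n m → Form2 t n → Form2 t m → n ≡ m
Form2-injective t n m f f′ = *-cancelˡ-≡ n m 2 (+-cancelʳ-≡ t _ _ (+-cancelʳ-≡ 1 _ _ (trans f (sym f′))))

Form3-injective : ∀ t n m → Form3 t n → Form3 t m → n ≡ m
Form3-injective t n m f f′ = *-cancelˡ-≡ n m 2 (+-cancelʳ-≡ t _ _ (trans f (sym f′)))

Form4-injective : ∀ t n m → Form4 t n → Form4 t m → n ≡ m
Form4-injective t n m f f′ = *-cancelˡ-≡ n m 2 (trans f (sym f′))


-- Coefficients of the butterfly series

butterflySeries-at : ∀ n {a b c} → (q^ 9 · one) n ≡ a → (q^ 12 · ψ 3) n ≡ b → (q^ 14 · ψ 3) n ≡ c →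
  butterflySeries n ≡ a ℤ.- b ℤ.- c
butterflySeries-at n refl refl refl = butterflySeries-ψ n

q^-ψ3-at : ∀ d k x {n} → n ≡ d + (ψExponent 3 k + x) → (q^ d · ψ 3) n ≡ ψ (3 + k) x
q^-ψ3-at d k x refl = trans (shift-at-+ 0ℤ d (ψ 3) _) (ψ-shift 2 k x)

butterflySeries-form1 : ∀ k → butterflySeries (14 + (ψExponent 3 k + (3 + k))) ≡ 1ℤ
butterflySeries-form1 k = butterflySeries-at n (q^-one-off 9 n (λ ()))
  (trans (q^-ψ3-at 12 k (5 + k) (regroup (ψExponent 3 k) k))
         (ψ-gap (2 + k) (>⇒≢ (n≤1+n (4 + k))) (1+m+o≡n⇒m<n (4 + 2 * k) (bound k))))
  (trans (q^-ψ3-at 14 k (3 + k) refl) (ψ-at-index (2 + k)))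
  where
    n = 14 + (ψExponent 3 k + (3 + k))
    regroup : ∀ E k → 14 + (E + (3 + k)) ≡ 12 + (E + (5 + k))
    regroup = ℕ-Ring.solve-∀
    bound : ∀ k → 6 + k + (4 + 2 * k) ≡ suc (3 * (3 + k))
    bound = ℕ-Ring.solve-∀

butterflySeries-form4 : ∀ k → butterflySeries (12 + (ψExponent 3 k + (3 + k))) ≡ 1ℤ
butterflySeries-form4 k = butterflySeries-at n (q^-one-off 9 n (λ ()))
  (trans (q^-ψ3-at 12 k (3 + k) refl) (ψ-at-index (2 + k)))
  (trans (q^-ψ3-at 14 k (1 + k) (regroup (ψExponent 3 k) k))
         (ψ-gap (2 + k) (m≢1+n+m k ∘ suc-injective) (1+m+o≡n⇒m<n (8 + 2 * k) (bound k))))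
  where
    n = 12 + (ψExponent 3 k + (3 + k))
    regroup : ∀ E k → 12 + (E + (3 + k)) ≡ 14 + (E + (1 + k))
    regroup = ℕ-Ring.solve-∀
    bound : ∀ k → 2 + k + (8 + 2 * k) ≡ suc (3 * (3 + k))
    bound = ℕ-Ring.solve-∀

butterflySeries-form2 : ∀ k → butterflySeries (12 + ψExponent 3 k) ≡ -1ℤ
butterflySeries-form2 zero    = refl
butterflySeries-form2 (suc k) = butterflySeries-at n (q^-one-off 9 n (λ ()))
  (trans (q^-ψ3-at 12 (suc k) 0 (cong (12 +_) (sym (+-identityʳ _)))) (ψ-at-0 (3 + k)))
  (trans (q^-ψ3-at 14 k (8 + 3 * k) (trans (cong (12 +_) (ψExponent-suc 3 k)) (regroup (ψExponent 3 k) k)))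
         (ψ-gap (2 + k) (>⇒≢ (1+m+o≡n⇒m<n (4 + 2 * k) (gap k))) (1+m+o≡n⇒m<n 1 (bound k))))
  where
    n = 12 + ψExponent 3 (suc k)
    regroup : ∀ E k → 12 + (E + suc (3 * (3 + k))) ≡ 14 + (E + (8 + 3 * k))
    regroup = ℕ-Ring.solve-∀
    gap : ∀ k → 4 + k + (4 + 2 * k) ≡ 8 + 3 * k
    gap = ℕ-Ring.solve-∀
    bound : ∀ k → 9 + 3 * k + 1 ≡ suc (3 * (3 + k))
    bound = ℕ-Ring.solve-∀

butterflySeries-form3 : ∀ k → butterflySeries (14 + ψExponent 3 k) ≡ -1ℤ
butterflySeries-form3 k = butterflySeries-at n (q^-one-off 9 n (λ ()))
  (trans (q^-ψ3-at 12 k 2 (regroup (ψExponent 3 k))) (ψ-gap (2 + k) {1} (λ ()) (1+m+o≡n⇒m<n (7 + 3 * k) (bound k))))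
  (trans (q^-ψ3-at 14 k 0 (cong (14 +_) (sym (+-identityʳ _)))) (ψ-at-0 (2 + k)))
  where
    n = 14 + ψExponent 3 k
    regroup : ∀ E → 14 + E ≡ 12 + (E + 2)
    regroup = ℕ-Ring.solve-∀
    bound : ∀ k → 3 + (7 + 3 * k) ≡ suc (3 * (3 + k))
    bound = ℕ-Ring.solve-∀

2≤2+ : ∀ k → 2 ≤ 2 + k
2≤2+ k = s≤s (s≤s z≤n)

ψ3-support-forms : ∀ M → ψ 3 M ≢ 0ℤ → AnyForm (12 + M) × AnyForm (14 + M)
ψ3-support-forms M ψ≢0 with ψ-support 2 M ψ≢0
... | k , inj₁ refl = (2 + k , 2≤2+ k , inj₂ (inj₁ (form2-point k))) ,
                      (2 + k , 2≤2+ k , inj₂ (inj₂ (inj₁ (form3-point k))))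
... | k , inj₂ refl = (2 + k , 2≤2+ k , inj₂ (inj₂ (inj₂ (form4-point k)))) ,
                      (3 + k , 2≤2+ (suc k) , inj₁ (form1-point k))

butterflySeries-¬AnyForm : ∀ n → ¬ AnyForm n → butterflySeries n ≡ 0ℤ
butterflySeries-¬AnyForm n ¬form = butterflySeries-at n at-9
  (shift-vanishes 0ℤ 12 (ψ 3) n (λ M 12+M≡n → ψ3-vanishes M (λ ψ≢0 → ¬form (subst AnyForm 12+M≡n (proj₁ (ψ3-support-forms M ψ≢0))))))
  (shift-vanishes 0ℤ 14 (ψ 3) n (λ M 14+M≡n → ψ3-vanishes M (λ ψ≢0 → ¬form (subst AnyForm 14+M≡n (proj₂ (ψ3-support-forms M ψ≢0))))))
  where
    ψ3-vanishes : ∀ M → ¬ ¬ ψ 3 M ≡ 0ℤ → ψ 3 M ≡ 0ℤ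
    ψ3-vanishes M = decidable-stable (ψ 3 M ℤ.≟ 0ℤ)
    at-9 : (q^ 9 · one) n ≡ 0ℤ
    at-9 with n ≟ 9
    ... | yes refl = ⊥-elim (¬form (2 , 2≤2+ 0 , inj₁ refl))
    ... | no n≢9   = q^-one-off 9 n n≢9

butterflySeries-MinusForm : ∀ n → MinusForm n → butterflySeries n ≡ 1ℤ
butterflySeries-MinusForm n (1 , s≤s () , _)
butterflySeries-MinusForm n (2 , _ , inj₁ f) =
  subst (λ m → butterflySeries m ≡ 1ℤ) (Form1-injective 2 9 n refl f) refl
butterflySeries-MinusForm n (suc (suc (suc k)) , _ , inj₁ f) =
  subst (λ m → butterflySeries m ≡ 1ℤ) (Form1-injective (3 + k) (14 + (ψExponent 3 k + (3 + k))) n (form1-point k) f) (butterflySeries-form1 k)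
butterflySeries-MinusForm n (suc (suc k) , _ , inj₂ f) =
  subst (λ m → butterflySeries m ≡ 1ℤ) (Form4-injective (2 + k) (12 + (ψExponent 3 k + (3 + k))) n (form4-point k) f) (butterflySeries-form4 k)

butterflySeries-PlusForm : ∀ n → PlusForm n → butterflySeries n ≡ -1ℤ
butterflySeries-PlusForm n (1 , s≤s () , _)
butterflySeries-PlusForm n (suc (suc k) , _ , inj₁ f) =
  subst (λ m → butterflySeries m ≡ -1ℤ) (Form2-injective (2 + k) (12 + ψExponent 3 k) n (form2-point k) f) (butterflySeries-form2 k)
butterflySeries-PlusForm n (suc (suc k) , _ , inj₂ f) =
  subst (λ m → butterflySeries m ≡ -1ℤ) (Form3-injective (2 + k) (14 + ψExponent 3 k) n (form3-point k) f) (butterflySeries-form3 k)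

difference⇒sum : ∀ {m n o} → ℤ.+ m ℤ.- ℤ.+ n ≡ ℤ.+ o → m ≡ n + o
difference⇒sum {m} {n} eq = ℤ.+-injective (trans (x≡y+[x-y] (ℤ.+ m) (ℤ.+ n)) (cong (ℤ._+_ (ℤ.+ n)) eq))
  where
    x≡y+[x-y] : ∀ x y → x ≡ y ℤ.+ (x ℤ.- y)
    x≡y+[x-y] = ℤ-Ring.solve-∀

difference-swap : ∀ x y → y ℤ.- x ≡ ℤ.- (x ℤ.- y)
difference-swap = ℤ-Ring.solve-∀

theorem4p6 : (n : ℕ) → 6 ≤ n →
    Σ ℕ (λ se → Σ ℕ (λ so →
    HasCount (ButterflyEven n) se × HasCount (ButterflyOdd n) so ×
    (¬ AnyForm n → se ≡ so) ×
    (MinusForm n → se + 1 ≡ so) ×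
    (PlusForm n → se ≡ so + 1)))
-- The hypothesis n ≥ 6 is unused: the identities hold for every n.
theorem4p6 n _ =
  length evens , length odds ,
  (evens , butterflies-unique even n , ∈-butterflies even-reflects n , refl) ,
  (odds , butterflies-unique odd n , ∈-butterflies (¬-reflects ∘ even-reflects) n , refl) ,
  (λ ¬form → sym (trans (difference⇒sum (odd−even≡ (butterflySeries-¬AnyForm n ¬form))) (+-identityʳ _))) ,
  (λ minus → sym (difference⇒sum (odd−even≡ (butterflySeries-MinusForm n minus)))) ,
  (λ plus → difference⇒sum (trans (difference-swap (lengthℤ odds) (lengthℤ evens)) (cong ℤ.-_ (odd−even≡ (butterflySeries-PlusForm n plus)))))
  where
    evens = butterflies even n
    odds = butterflies odd n
    odd−even≡ : ∀ {d} → butterflySeries n ≡ d → lengthℤ odds ℤ.- lengthℤ evens ≡ d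
    odd−even≡ = trans (butterflies-difference n)
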